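{- Let $m,n\ge 3$. If $\vec C_m \mathbin{\Box} \vec C_n$ has a hamiltonian cycle, then $P(\vec C_m \mathbin{\Box} \vec C_n)$ has no hamiltonian cycle.
   Context: $\vec C_k$ is a directed cycle of length $k$. The Cartesian product $X\mathbin{\Box}Y$ of digraphs has vertex set $V(X)\times V(Y)$, with a directed edge from $(x_1,y_1)$ to $(x_2,y_2)$ iff either $x_1=x_2$ and $y_1\to y_2$ is an edge of $Y$, or $y_1=y_2$ and $x_1\to x_2$ is an edge of $X$. For a vertex-transitive digraph $X$, $P(X)$ is the digraph obtained from $X$ by choosing a vertex $v$ and reversing the orientation of every directed edge incident with $v$; its isomorphism class does not depend on the choice of $v$. -}

module Defs where

open import Level using (0ℓ)
open import Data.Nat using (ℕ; zero; suc; _≥_)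
open import Data.Fin using (Fin; toℕ) renaming (zero to fzero; suc to fsuc)
open import Data.Nat.DivMod using (_mod_)
open import Data.Product using (Σ; _×_; _,_; ∃)
open import Data.Sum using (_⊎_)
open import Relation.Binary.PropositionalEquality using (_≡_)
open import Relation.Nullary using (¬_)
open import Function.Definitions using (Injective; Surjective)

record Digraph : Set₁ where
  field
    V : Set
    E : V → V → Set
open Digraph public

sucMod : ∀ {n} → Fin n → Fin n
sucMod {suc n} i = (suc (toℕ i)) mod (suc n)

DirCycle : ℕ → Digraph
DirCycle k = record { V = Fin k ; E = λ i j → j ≡ sucMod i }

_□_ : Digraph → Digraph → Digraph
X □ Y = record
  { V = V X × V Y
  ; E = λ { (x₁ , y₁) (x₂ , y₂) →
            (x₁ ≡ x₂ × E Y y₁ y₂) ⊎ (y₁ ≡ y₂ × E X x₁ x₂) } }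

reverseAt : (G : Digraph) → V G → Digraph
reverseAt G v = record
  { V = V G
  ; E = λ x y → (¬ x ≡ v × ¬ y ≡ v × E G x y)
              ⊎ ((x ≡ v ⊎ y ≡ v) × E G y x) }

HamiltonianCycle : Digraph → Set
HamiltonianCycle G =
  Σ ℕ λ L → Σ (Fin (suc L) → V G) λ w →
    Injective _≡_ _≡_ w × Surjective _≡_ _≡_ w ×
    ((i : Fin (suc L)) → E G (w i) (w (sucMod i)))

module Submission where

-- Write the vertices of C_m □ C_n as v ⊕ (p , q) with p , q ∈ ℤ, and a hamiltonian cycle as its
-- successor function; away from the reversed vertex v every step is e₁ = (1 , 0) or e₂ = (0 , 1).
-- The basic observation: if x steps along e₁, then x ⊕ e₂ can only be entered from x ⊕ δ,
-- δ = (-1 , 1), which therefore steps along e₁ as well.  By the Chinese remainder theorem the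
-- antidiagonal x ⊕ r δ reaches every vertex whose coordinate sum agrees with that of x modulo
-- g = gcd m n.  If g = 1, all steps of a cycle of C_m □ C_n therefore go in the same direction and
-- it stays in one row or column, so C_m □ C_n is not hamiltonian.  In P(C_m □ C_n) the reversal
-- forces the steps v ⊕ (-1 , 1) ↦ v ⊕ e₂ and v ⊕ (1 , -1) ↦ v ⊕ e₁.  If g ≥ 3, the antidiagonal
-- class of v stays away from the neighbourhood of v, so the first e₁-step propagates to the second
-- vertex, which steps along e₂.  If g = 2, the same propagation rules out the two-step patterns
-- e₁e₂ and e₂e₁ from vertices of even coordinate sum; hence every second vertex after v is v or has
-- both coordinates odd, and v ⊕ (0 , 2) is never visited.

open import Defs
open import Data.Nat as ℕ using (ℕ; zero; suc; z≤n; s≤s; NonZero; _≥_)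
import Data.Nat.Properties as ℕP
import Data.Nat.Divisibility as ℕ∣
import Data.Nat.DivMod as ℕDM
open import Data.Nat.GCD using (gcd; gcd-GCD; module Bézout)
import Data.Nat.GCD as GCD
open import Data.Integer as ℤ using (ℤ; +_; _+_; _-_; _*_; -_; 0ℤ; 1ℤ; -1ℤ; _%ℕ_; _/ℕ_)
import Data.Integer.Properties as ℤP
open import Data.Integer.DivMod using (n%ℕd<d; a≡a%ℕn+[a/ℕn]*n)
open import Data.Integer.Divisibility.Signed
  using (_∣_; divides; ∣ᵤ⇒∣; ∣⇒∣ᵤ; ∣-trans; ∣m∣n⇒∣m+n; ∣m∣n⇒∣m-n; ∣m⇒∣-m)
open import Data.Integer.Tactic.RingSolver using (solve-∀)
open import Data.Fin as F using (Fin; toℕ)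
import Data.Fin.Properties as FP
open import Data.Product using (Σ; ∃-syntax; _×_; _,_; proj₁; proj₂; swap)
open import Data.Product.Properties using () renaming (≡-dec to ×-≡-dec)
open import Data.Sum using (_⊎_; inj₁; inj₂)
import Data.Sum as Sum
open import Data.Empty using (⊥-elim)
open import Function using (_∘_)
open import Relation.Nullary using (¬_; yes; no)
open import Relation.Binary.Definitions using (DecidableEquality)
open import Relation.Binary.PropositionalEquality

d∣k∧∣k∣<d⇒k≡0 : ∀ {d k} → + d ∣ k → ℤ.∣ k ∣ ℕ.< d → k ≡ 0ℤ
d∣k∧∣k∣<d⇒k≡0 {d} {k} d∣k ∣k∣<d with ℤ.∣ k ∣ in eq
... | zero  = ℤP.∣i∣≡0⇒i≡0 eq
... | suc _ = ⊥-elim (ℕP.<⇒≱ ∣k∣<d (ℕ∣.∣⇒≤ (subst (d ℕ∣.∣_) eq (∣⇒∣ᵤ d∣k))))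

∣k∣<d⇒d∤k : ∀ {d} k → k ≢ 0ℤ → ℤ.∣ k ∣ ℕ.< d → ¬ + d ∣ k
∣k∣<d⇒d∤k k k≢0 ∣k∣<d d∣k = k≢0 (d∣k∧∣k∣<d⇒k≡0 d∣k ∣k∣<d)

toℕ-injective-mod : ∀ {d} {i j : Fin d} → + d ∣ + toℕ i - + toℕ j → i ≡ j
toℕ-injective-mod {d} {i} {j} d∣i-j =
  FP.toℕ-injective (ℤP.+-injective (ℤP.i-j≡0⇒i≡j _ _ (d∣k∧∣k∣<d⇒k≡0 d∣i-j ∣i-j∣<d)))
  where
  ∣i-j∣<d : ℤ.∣ + toℕ i - + toℕ j ∣ ℕ.< d
  ∣i-j∣<d = subst (ℕ._< d) (cong ℤ.∣_∣ (sym (ℤP.m-n≡m⊖n (toℕ i) (toℕ j))))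
    (ℕP.≤-<-trans (ℤP.∣m⊝n∣≤m⊔n (toℕ i) (toℕ j)) (ℕP.⊔-lub (FP.toℕ<n i) (FP.toℕ<n j)))

module Cyclic (d : ℕ) .{{_ : NonZero d}} where

  -- Opaque: otherwise unification unfolds the division algorithm inside fromℤ and _⊕_ and explodes.
  opaque
    fromℤ : ℤ → Fin d
    fromℤ k = F.fromℕ< (n%ℕd<d k d)

    toℕ-fromℤ : ∀ k → toℕ (fromℤ k) ≡ k %ℕ d
    toℕ-fromℤ k = FP.toℕ-fromℕ< (n%ℕd<d k d)

  ∣-fromℤ : ∀ k → + d ∣ k - + toℕ (fromℤ k)
  ∣-fromℤ k = divides (k /ℕ d) (begin
    k - + toℕ (fromℤ k)                        ≡⟨ cong (λ r → k - + r) (toℕ-fromℤ k) ⟩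
    k - + (k %ℕ d)                             ≡⟨ cong (_- + (k %ℕ d)) (a≡a%ℕn+[a/ℕn]*n k d) ⟩
    (+ (k %ℕ d) + (k /ℕ d) * + d) - + (k %ℕ d) ≡⟨ +-cancelˡ (+ (k %ℕ d)) _ ⟩
    (k /ℕ d) * + d                             ∎)
    where
    open ≡-Reasoning
    +-cancelˡ : ∀ r s → (r + s) - r ≡ s
    +-cancelˡ = solve-∀

  fromℤ-cong : ∀ k l → + d ∣ k - l → fromℤ k ≡ fromℤ l
  fromℤ-cong k l d∣k-l = toℕ-injective-mod (subst (+ d ∣_) (rearrange k l _ _)
    (∣m∣n⇒∣m+n (∣m∣n⇒∣m-n d∣k-l (∣-fromℤ k)) (∣-fromℤ l)))
    where
    rearrange : ∀ k l r s → ((k - l) - (k - r)) + (l - s) ≡ r - s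
    rearrange = solve-∀

  fromℤ-≡⇒∣ : ∀ k l → fromℤ k ≡ fromℤ l → + d ∣ k - l
  fromℤ-≡⇒∣ k l eq = subst (+ d ∣_) (rearrange k l _)
    (∣m∣n⇒∣m-n (∣-fromℤ k) (subst (λ i → + d ∣ l - + toℕ i) (sym eq) (∣-fromℤ l)))
    where
    rearrange : ∀ k l r → (k - r) - (l - r) ≡ k - l
    rearrange = solve-∀

  fromℤ-toℕ : ∀ i → fromℤ (+ toℕ i) ≡ i
  fromℤ-toℕ i = FP.toℕ-injective (trans (toℕ-fromℤ (+ toℕ i)) (ℕDM.m<n⇒m%n≡m (FP.toℕ<n i)))

  infixl 6 _⊕_
  opaque
    _⊕_ : Fin d → ℤ → Fin d
    i ⊕ k = fromℤ (+ toℕ i + k)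

    toℕ-⊕ : ∀ i k → toℕ (i ⊕ k) ≡ (+ toℕ i + k) %ℕ d
    toℕ-⊕ i k = toℕ-fromℤ (+ toℕ i + k)

    ⊕-identityʳ : ∀ i → i ⊕ 0ℤ ≡ i
    ⊕-identityʳ i = trans (cong fromℤ (ℤP.+-identityʳ (+ toℕ i))) (fromℤ-toℕ i)

    ⊕-assoc : ∀ i k l → (i ⊕ k) ⊕ l ≡ i ⊕ (k + l)
    ⊕-assoc i k l = fromℤ-cong (+ toℕ (i ⊕ k) + l) (+ toℕ i + (k + l))
      (subst (+ d ∣_) (rearrange (+ toℕ i) k l _) (∣m⇒∣-m (∣-fromℤ (+ toℕ i + k))))
      where
      rearrange : ∀ i k l r → - ((i + k) - r) ≡ (r + l) - (i + (k + l))
      rearrange = solve-∀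

    ⊕-cong : ∀ i {k l} → + d ∣ k - l → i ⊕ k ≡ i ⊕ l
    ⊕-cong i {k} {l} d∣k-l =
      fromℤ-cong (+ toℕ i + k) (+ toℕ i + l) (subst (+ d ∣_) (rearrange (+ toℕ i) k l) d∣k-l)
      where
      rearrange : ∀ i k l → k - l ≡ (i + k) - (i + l)
      rearrange = solve-∀

    ⊕-cancelˡ : ∀ i {k l} → i ⊕ k ≡ i ⊕ l → + d ∣ k - l
    ⊕-cancelˡ i {k} {l} eq =
      subst (+ d ∣_) (rearrange (+ toℕ i) k l) (fromℤ-≡⇒∣ (+ toℕ i + k) (+ toℕ i + l) eq)
      where
      rearrange : ∀ i k l → (i + k) - (i + l) ≡ k - l
      rearrange = solve-∀

    ⊕-transitive : ∀ i j → ∃[ r ] j ≡ i ⊕ + r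
    ⊕-transitive i j = toℕ (fromℤ j-i) , sym (trans
      (fromℤ-cong (+ toℕ i + + toℕ (fromℤ j-i)) (+ toℕ j)
        (subst (+ d ∣_) (rearrange (+ toℕ i) (+ toℕ j) _) (∣m⇒∣-m (∣-fromℤ j-i))))
      (fromℤ-toℕ j))
      where
      j-i : ℤ
      j-i = + toℕ j - + toℕ i
      rearrange : ∀ i j r → - ((j - i) - r) ≡ (i + r) - j
      rearrange = solve-∀

  ⊕-inverse : ∀ i k → (i ⊕ k) ⊕ (- k) ≡ i
  ⊕-inverse i k =
    trans (⊕-assoc i k (- k)) (trans (cong (i ⊕_) (ℤP.+-inverseʳ k)) (⊕-identityʳ i))

  ⊕1-closed : (P : Fin d → Set) → (∀ i → P i → P (i ⊕ 1ℤ)) →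
              ∀ {i} → P i → ∀ r → P (i ⊕ + r)
  ⊕1-closed P step {i} Pi zero    = subst P (sym (⊕-identityʳ i)) Pi
  ⊕1-closed P step {i} Pi (suc r) = subst P (⊕-assoc i 1ℤ (+ r)) (⊕1-closed P step (step i Pi) r)

sucMod≡⊕1 : ∀ {d} (i : Fin (suc d)) → sucMod i ≡ Cyclic._⊕_ (suc d) i 1ℤ
sucMod≡⊕1 {d} i = FP.toℕ-injective (trans (FP.toℕ-fromℕ< _) (trans
  (cong (ℕ._% suc d) (ℕP.+-comm 1 (toℕ i))) (sym (Cyclic.toℕ-⊕ (suc d) i 1ℤ))))

record Cycle (A : Set) : Set₁ where
  field
    next           : A → A
    prev           : A → A
    next-prev      : ∀ x → next (prev x) ≡ x
    next-injective : ∀ {x y} → next x ≡ next y → x ≡ y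
    induction      : (P : A → Set) → ∀ {x} → P x → (∀ y → P y → P (next y)) → ∀ y → P y

transpose : ∀ {A B} → Cycle (A × B) → Cycle (B × A)
transpose C = record
  { next           = swap ∘ next ∘ swap
  ; prev           = swap ∘ prev ∘ swap
  ; next-prev      = λ x → cong swap (next-prev (swap x))
  ; next-injective = λ eq → cong swap (next-injective (cong swap eq))
  ; induction      = λ P Px step y → induction (P ∘ swap) Px (λ z → step (swap z)) (swap y)
  }
  where open Cycle C

hamiltonian⇒cycle : ∀ G → HamiltonianCycle G →
                    Σ (Cycle (V G)) λ C → ∀ x → E G x (Cycle.next C x)
hamiltonian⇒cycle G (L , w , w-injective , w-surjective , w-edge) = C , edge
  where
  open Cyclic (suc L)

  index : V G → Fin (suc L)
  index x = proj₁ (w-surjective x)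

  w-index : ∀ x → w (index x) ≡ x
  w-index x = proj₂ (w-surjective x) refl

  index-w : ∀ i → index (w i) ≡ i
  index-w i = w-injective (w-index (w i))

  next-w : ∀ i → w (index (w i) ⊕ 1ℤ) ≡ w (i ⊕ 1ℤ)
  next-w i = cong (λ j → w (j ⊕ 1ℤ)) (index-w i)

  C : Cycle (V G)
  C = record
    { next           = λ x → w (index x ⊕ 1ℤ)
    ; prev           = λ x → w (index x ⊕ -1ℤ)
    ; next-prev      = λ x → trans (next-w (index x ⊕ -1ℤ))
                               (trans (cong w (⊕-inverse (index x) -1ℤ)) (w-index x))
    ; next-injective = λ {x} {y} eq → trans (sym (w-index x)) (trans
                         (cong w (trans (sym (⊕-inverse (index x) 1ℤ))
                           (trans (cong (_⊕ -1ℤ) (w-injective eq)) (⊕-inverse (index y) 1ℤ))))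
                         (w-index y))
    ; induction      = λ P {x} Px step y →
                         subst P (w-index y) (fin-induction P (subst P (sym (w-index x)) Px) step (index y))
    }
    where
    fin-induction : (P : V G → Set) → ∀ {i} → P (w i) →
                    (∀ y → P y → P (w (index y ⊕ 1ℤ))) → ∀ j → P (w j)
    fin-induction P {i} Pi step j with ⊕-transitive i j
    ... | r , refl = ⊕1-closed (P ∘ w) (λ k Pk → subst P (next-w k) (step (w k) Pk)) Pi r

  edge : ∀ x → E G x (Cycle.next C x)
  edge x = subst₂ (E G) (w-index x) (cong w (sucMod≡⊕1 (index x))) (w-edge (index x))

pos-identity : ∀ a b c d e → a ℕ.+ b ℕ.* c ≡ d ℕ.* e → + a + + b * + c ≡ + d * + e
pos-identity a b c d e eq = trans (cong (λ z → + a + z) (sym (ℤP.pos-* b c)))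
  (trans (sym (ℤP.pos-+ a (b ℕ.* c))) (trans (cong +_ eq) (ℤP.pos-* d e)))

module _ (m n : ℕ) .{{_ : NonZero m}} .{{_ : NonZero n}} where

  private
    instance
      mn≢0 : NonZero (m ℕ.* n)
      mn≢0 = ℕP.m*n≢0 m n

  bézout-ℤ : ∃[ a ] ∃[ b ] + gcd m n ≡ a * + m + b * + n
  bézout-ℤ with Bézout.identity (gcd-GCD m n)
  ... | Bézout.+- x y g+yn≡xm = + x , - + y , (begin
    G                           ≡⟨ split G (+ y) (+ n) ⟩
    (G + + y * + n) - + y * + n ≡⟨ cong (_- + y * + n) (pos-identity g y n x m g+yn≡xm) ⟩
    + x * + m - + y * + n       ≡⟨ cong (λ z → + x * + m + z) (ℤP.neg-distribˡ-* (+ y) (+ n)) ⟩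
    + x * + m + - + y * + n     ∎)
    where
    open ≡-Reasoning
    g = gcd m n
    G = + g
    split : ∀ g y n → g ≡ (g + y * n) - y * n
    split = solve-∀
  ... | Bézout.-+ x y g+xm≡yn = - + x , + y , (begin
    G                             ≡⟨ split G (+ x) (+ m) ⟩
    - + x * + m + (G + + x * + m) ≡⟨ cong (λ z → - + x * + m + z) (pos-identity g x m y n g+xm≡yn) ⟩
    - + x * + m + + y * + n       ∎)
    where
    open ≡-Reasoning
    g = gcd m n
    G = + g
    split : ∀ g x m → g ≡ - x * m + (g + x * m)
    split = solve-∀

  crt-ℤ : ∀ {g a b} → + g ≡ a * + m + b * + n →
          ∀ s t → + g ∣ s - t → ∃[ r ] (+ m ∣ r - s × + n ∣ r - t)
  crt-ℤ {g} {a} {b} g≡am+bn s t (divides k s-t≡kg) =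
    s - k * a * + m , divides (- (k * a)) (cancel-s s (k * a) (+ m)) , divides (k * b) (begin
      (s - k * a * + m) - t                 ≡⟨ reorder s t (k * a * + m) ⟩
      (s - t) - k * a * + m                 ≡⟨ cong (_- k * a * + m) s-t≡k[am+bn] ⟩
      k * (a * + m + b * + n) - k * a * + m ≡⟨ factor k a b (+ m) (+ n) ⟩
      k * b * + n                           ∎)
    where
    open ≡-Reasoning
    s-t≡k[am+bn] = trans s-t≡kg (cong (k *_) g≡am+bn)
    cancel-s : ∀ s c m → (s - c * m) - s ≡ - c * m
    cancel-s = solve-∀
    reorder : ∀ s t c → (s - c) - t ≡ (s - t) - c
    reorder = solve-∀
    factor : ∀ k a b m n → k * (a * m + b * n) - k * a * m ≡ k * b * n
    factor = solve-∀

  crt : ∀ s t → + gcd m n ∣ s - t → ∃[ r ] (+ m ∣ + r - s × + n ∣ + r - t)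
  crt s t g∣s-t with bézout-ℤ
  ... | a , b , g≡am+bn with crt-ℤ {a = a} {b} g≡am+bn s t g∣s-t
  ... | r , m∣r-s , n∣r-t = toℕ (fromℤ r) ,
    shift (∣-trans (∣ᵤ⇒∣ (ℕ∣.m∣m*n n)) mn∣r-r′) m∣r-s ,
    shift (∣-trans (∣ᵤ⇒∣ (ℕ∣.n∣m*n m)) mn∣r-r′) n∣r-t
    where
    open Cyclic (m ℕ.* n)
    mn∣r-r′ : + (m ℕ.* n) ∣ r - + toℕ (fromℤ r)
    mn∣r-r′ = ∣-fromℤ r
    shift : ∀ {d s} → d ∣ r - + toℕ (fromℤ r) → d ∣ r - s → d ∣ + toℕ (fromℤ r) - s
    shift {d} {s} d∣r-r′ d∣r-s =
      subst (d ∣_) (rearrange r (+ toℕ (fromℤ r)) s) (∣m∣n⇒∣m-n d∣r-s d∣r-r′)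
      where
      rearrange : ∀ r r′ s → (r - s) - (r - r′) ≡ r′ - s
      rearrange = solve-∀

ℤ² : Set
ℤ² = ℤ × ℤ

infixl 6 _+²_
_+²_ : ℤ² → ℤ² → ℤ²
(p , q) +² (p′ , q′) = p + p′ , q + q′

-²_ : ℤ² → ℤ²
-² (p , q) = - p , - q

diag : ℤ² → ℤ
diag (p , q) = p + q

diag-+² : ∀ u w → diag (u +² w) ≡ diag u + diag w
diag-+² (p , q) (p′ , q′) = interchange p q p′ q′
  where
  interchange : ∀ p q p′ q′ → (p + p′) + (q + q′) ≡ (p + q) + (p′ + q′)
  interchange = solve-∀

e₁ e₂ δ : ℤ²
e₁ = 1ℤ , 0ℤ
e₂ = 0ℤ , 1ℤ
δ  = -1ℤ , 1ℤ

antidiagonal : ℕ → ℤ²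
antidiagonal r = - + r , + r

record Congruent (d₁ d₂ : ℕ) (u w : ℤ²) : Set where
  constructor congruent
  field
    congruent₁ : + d₁ ∣ proj₁ u - proj₁ w
    congruent₂ : + d₂ ∣ proj₂ u - proj₂ w
open Congruent public

module _ {d₁ d₂ : ℕ} where

  congruent-sym : ∀ {u w} → Congruent d₁ d₂ u w → Congruent d₁ d₂ w u
  congruent-sym {p , q} {p′ , q′} (congruent d₁∣ d₂∣) = congruent
    (subst (+ d₁ ∣_) (neg-minus p p′) (∣m⇒∣-m d₁∣))
    (subst (+ d₂ ∣_) (neg-minus q q′) (∣m⇒∣-m d₂∣))
    where
    neg-minus : ∀ a b → - (a - b) ≡ b - a
    neg-minus = solve-∀

  congruent-trans : ∀ {u w z} → Congruent d₁ d₂ u w → Congruent d₁ d₂ w z →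
                    Congruent d₁ d₂ u z
  congruent-trans {p , q} {p′ , q′} {p″ , q″} (congruent d₁∣ d₂∣) (congruent d₁∣′ d₂∣′) =
    congruent (subst (+ d₁ ∣_) (telescope p p′ p″) (∣m∣n⇒∣m+n d₁∣ d₁∣′))
              (subst (+ d₂ ∣_) (telescope q q′ q″) (∣m∣n⇒∣m+n d₂∣ d₂∣′))
    where
    telescope : ∀ a b c → (a - b) + (b - c) ≡ a - c
    telescope = solve-∀

  congruent-+² : ∀ {u w} z → Congruent d₁ d₂ u w → Congruent d₁ d₂ (u +² z) (w +² z)
  congruent-+² {p , q} {p′ , q′} (r , s) (congruent d₁∣ d₂∣) =
    congruent (subst (+ d₁ ∣_) (cancel p p′ r) d₁∣) (subst (+ d₂ ∣_) (cancel q q′ s) d₂∣)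
    where
    cancel : ∀ a b c → a - b ≡ (a + c) - (b + c)
    cancel = solve-∀

  congruent-coarsen : ∀ {c₁ c₂ u w} → c₁ ℕ∣.∣ d₁ → c₂ ℕ∣.∣ d₂ →
                      Congruent d₁ d₂ u w → Congruent c₁ c₂ u w
  congruent-coarsen c₁∣d₁ c₂∣d₂ (congruent d₁∣ d₂∣) =
    congruent (∣-trans (∣ᵤ⇒∣ c₁∣d₁) d₁∣) (∣-trans (∣ᵤ⇒∣ c₂∣d₂) d₂∣)

module Torus (m n : ℕ) .{{_ : NonZero m}} .{{_ : NonZero n}} where

  private
    module M = Cyclic m
    module N = Cyclic n

  Vertex : Set
  Vertex = Fin m × Fin n

  infix 4 _≈_
  _≈_ : ℤ² → ℤ² → Set
  _≈_ = Congruent m n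

  _≟_ : DecidableEquality Vertex
  _≟_ = ×-≡-dec FP._≟_ FP._≟_

  infixl 6 _⊕_
  _⊕_ : Vertex → ℤ² → Vertex
  (i , j) ⊕ (p , q) = i M.⊕ p , j N.⊕ q

  ⊕-identityʳ : ∀ x → x ⊕ (0ℤ , 0ℤ) ≡ x
  ⊕-identityʳ (i , j) = cong₂ _,_ (M.⊕-identityʳ i) (N.⊕-identityʳ j)

  ⊕-assoc : ∀ x u w → x ⊕ u ⊕ w ≡ x ⊕ (u +² w)
  ⊕-assoc (i , j) (p , q) (p′ , q′) = cong₂ _,_ (M.⊕-assoc i p p′) (N.⊕-assoc j q q′)

  ⊕-inverse : ∀ x u → x ⊕ u ⊕ (-² u) ≡ x
  ⊕-inverse (i , j) (p , q) = cong₂ _,_ (M.⊕-inverse i p) (N.⊕-inverse j q)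

  ⊕-cong : ∀ x {u w} → u ≈ w → x ⊕ u ≡ x ⊕ w
  ⊕-cong (i , j) (congruent m∣ n∣) = cong₂ _,_ (M.⊕-cong i m∣) (N.⊕-cong j n∣)

  ⊕-cancelˡ : ∀ x {u w} → x ⊕ u ≡ x ⊕ w → u ≈ w
  ⊕-cancelˡ (i , j) {_ , _} {_ , _} eq =
    congruent (M.⊕-cancelˡ i (cong proj₁ eq)) (N.⊕-cancelˡ j (cong proj₂ eq))

  ⊕-fixed⇒≈0 : ∀ x {u} → x ⊕ u ≡ x → u ≈ (0ℤ , 0ℤ)
  ⊕-fixed⇒≈0 x eq = ⊕-cancelˡ x (trans eq (sym (⊕-identityʳ x)))

  ⊕-cancelʳ : ∀ {x y} u → x ⊕ u ≡ y ⊕ u → x ≡ y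
  ⊕-cancelʳ {x} {y} u eq = trans (sym (⊕-inverse x u)) (trans (cong (_⊕ -² u) eq) (⊕-inverse y u))

  ⊕-≡⇒≡-⊕ : ∀ {x y} u → x ⊕ u ≡ y → x ≡ y ⊕ (-² u)
  ⊕-≡⇒≡-⊕ {x} u refl = sym (⊕-inverse x u)

  ⊕-transitive : ∀ x y → ∃[ u ] y ≡ x ⊕ u
  ⊕-transitive (i , j) (i′ , j′) with M.⊕-transitive i i′ | N.⊕-transitive j j′
  ... | p , refl | q , refl = (+ p , + q) , refl

  ≈⇒∣diag : ∀ {g u w} → g ℕ∣.∣ m → g ℕ∣.∣ n → u ≈ w → + g ∣ diag u - diag w
  ≈⇒∣diag {g} {p , q} {p′ , q′} g∣m g∣n u≈w with congruent-coarsen g∣m g∣n u≈w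
  ... | congruent g∣₁ g∣₂ = subst (+ g ∣_) (rearrange p q p′ q′) (∣m∣n⇒∣m+n g∣₁ g∣₂)
    where
    rearrange : ∀ p q p′ q′ → (p - p′) + (q - q′) ≡ (p + q) - (p′ + q′)
    rearrange = solve-∀

  ⊕-≢-diag : ∀ {g} → g ℕ∣.∣ m → g ℕ∣.∣ n → ∀ x {u w w′} →
             + g ∣ diag u → ¬ + g ∣ diag w - diag w′ → x ⊕ u ⊕ w ≢ x ⊕ w′
  ⊕-≢-diag {g} g∣m g∣n x {u} {w} {w′} g∣u g∤w-w′ eq =
    g∤w-w′ (subst (+ g ∣_) (rearrange (diag u) (diag w) (diag w′)) (∣m∣n⇒∣m-n g∣u+w-w′ g∣u))
    where
    g∣u+w-w′ : + g ∣ (diag u + diag w) - diag w′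
    g∣u+w-w′ = subst (λ k → + g ∣ k - diag w′) (diag-+² u w)
      (≈⇒∣diag g∣m g∣n (⊕-cancelˡ x (trans (sym (⊕-assoc x u w)) eq)))
    rearrange : ∀ a b c → ((a + b) - c) - a ≡ b - c
    rearrange = solve-∀

  OnDiagonal : ℕ → Vertex → Vertex → Set
  OnDiagonal g v x = ∃[ u ] x ≡ v ⊕ u × + g ∣ diag u

  onDiagonal-δ : ∀ {g v x} → OnDiagonal g v x → OnDiagonal g v (x ⊕ δ)
  onDiagonal-δ {g} {v} (u , refl , g∣u) =
    u +² δ , ⊕-assoc v u δ , subst (+ g ∣_) (sym (trans (diag-+² u δ) (ℤP.+-identityʳ (diag u)))) g∣u

  antidiagonal-orbit : (P : Vertex → Set) → (∀ y → P y → P (y ⊕ δ)) →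
                       ∀ {x} → P x → ∀ r → P (x ⊕ antidiagonal r)
  antidiagonal-orbit P step {x} Px zero    = subst P (sym (⊕-identityʳ x)) Px
  antidiagonal-orbit P step {x} Px (suc r) =
    subst P (trans (⊕-assoc x δ (antidiagonal r)) (cong (λ p → x ⊕ (p , + suc r)) (-1-r≡-[1+r] r)))
      (antidiagonal-orbit P step (step x Px) r)
    where
    -1-r≡-[1+r] : ∀ r → -1ℤ + - + r ≡ - + suc r
    -1-r≡-[1+r] zero    = refl
    -1-r≡-[1+r] (suc r) = refl

  antidiagonal-closed : (P : Vertex → Set) → (∀ y → P y → P (y ⊕ δ)) →
                        ∀ x {u w} → + gcd m n ∣ diag u - diag w → P (x ⊕ u) → P (x ⊕ w)
  antidiagonal-closed P step x {p , q} {p′ , q′} g∣ Pxu =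
    subst P x⊕u⊕r≡x⊕w (antidiagonal-orbit P step Pxu r)
    where
    rearrange : ∀ p q p′ q′ → (p + q) - (p′ + q′) ≡ (p - p′) - (q′ - q)
    rearrange = solve-∀
    solution = crt m n (p - p′) (q′ - q) (subst (+ gcd m n ∣_) (rearrange p q p′ q′) g∣)
    r = proj₁ solution
    first : ∀ p p′ r → - (r - (p - p′)) ≡ (p + - r) - p′
    first = solve-∀
    second : ∀ q q′ r → r - (q′ - q) ≡ (q + r) - q′
    second = solve-∀
    x⊕u⊕r≡x⊕w : x ⊕ (p , q) ⊕ antidiagonal r ≡ x ⊕ (p′ , q′)
    x⊕u⊕r≡x⊕w = trans (⊕-assoc x (p , q) (antidiagonal r)) (⊕-cong x (congruent
      (subst (+ m ∣_) (first p p′ (+ r)) (∣m⇒∣-m (proj₁ (proj₂ solution))))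
      (subst (+ n ∣_) (second q q′ (+ r)) (proj₂ (proj₂ solution)))))

transpose-onDiagonal : ∀ {m n} .{{_ : NonZero m}} .{{_ : NonZero n}} {g v x} →
                       Torus.OnDiagonal m n g v x → Torus.OnDiagonal n m g (swap v) (swap x)
transpose-onDiagonal ((p , q) , refl , g∣p+q) = (q , p) , refl , subst (+ _ ∣_) (ℤP.+-comm p q) g∣p+q

module Walk {m n : ℕ} .{{_ : NonZero m}} .{{_ : NonZero n}} (C : Cycle (Torus.Vertex m n)) where

  open Torus m n
  open Cycle C

  Step : ℤ² → Vertex → Set
  Step u x = next x ≡ x ⊕ u

  Regular : Vertex → Set
  Regular x = Step e₁ x ⊎ Step e₂ x

  -- x ⊕ e₂ is not entered from x, so (if its predecessor is regular) it is entered from x ⊕ δ.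
  propagate : 1 ℕ.< m → ∀ x → Regular (prev (x ⊕ e₂)) → Step e₁ x → Step e₁ (x ⊕ δ)
  propagate 1<m x (inj₁ step-e₁) _ = begin
      next (x ⊕ δ)     ≡⟨ cong next (sym y≡x⊕δ) ⟩
      next y           ≡⟨ next-prev (x ⊕ e₂) ⟩
      x ⊕ e₂           ≡⟨ sym (⊕-assoc x δ e₁) ⟩
      x ⊕ δ ⊕ e₁       ∎
    where
    open ≡-Reasoning
    y = prev (x ⊕ e₂)
    y≡x⊕δ : y ≡ x ⊕ δ
    y≡x⊕δ = trans (⊕-≡⇒≡-⊕ e₁ (trans (sym step-e₁) (next-prev (x ⊕ e₂))))
                  (⊕-assoc x e₂ (-² e₁))
  propagate 1<m x (inj₂ step-e₂) step-e₁ =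
    ⊥-elim (∣k∣<d⇒d∤k 1ℤ (λ ()) 1<m (congruent₁ (⊕-cancelˡ x (begin
      x ⊕ e₁           ≡⟨ sym step-e₁ ⟩
      next x           ≡⟨ cong next (sym y≡x) ⟩
      next y           ≡⟨ next-prev (x ⊕ e₂) ⟩
      x ⊕ e₂           ∎))))
    where
    open ≡-Reasoning
    y = prev (x ⊕ e₂)
    y≡x : y ≡ x
    y≡x = ⊕-cancelʳ e₂ (trans (sym step-e₂) (next-prev (x ⊕ e₂)))

module _ {m n : ℕ} .{{_ : NonZero m}} .{{_ : NonZero n}} (1<m : 1 ℕ.< m) (1<n : 1 ℕ.< n)
         (gcd≡1 : gcd m n ≡ 1) (C : Cycle (Torus.Vertex m n)) (regular : ∀ x → Walk.Regular C x) where

  open Torus m n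
  open Cycle C
  open Walk C

  regular-coprime⇒¬Step-e₁ : ∀ v → ¬ Step e₁ v
  regular-coprime⇒¬Step-e₁ v step-v =
    not-in-row (induction InRow (step-v , 0ℤ , sym (⊕-identityʳ v)) next-in-row (v ⊕ e₂))
    where
    step-e₁-shift : ∀ x → Step e₁ x → Step e₁ (x ⊕ e₁)
    step-e₁-shift x s = antidiagonal-closed (Step e₁) (λ y → propagate 1<m y (regular _)) x
      (divides -1ℤ (cong (λ g → -1ℤ * + g) (sym gcd≡1))) (subst (Step e₁) (sym (⊕-identityʳ x)) s)

    InRow : Vertex → Set
    InRow x = Step e₁ x × ∃[ p ] x ≡ v ⊕ (p , 0ℤ)

    next-in-row : ∀ x → InRow x → InRow (next x)
    next-in-row x (s , p , refl) = subst InRow (sym s) (step-e₁-shift x s , p + 1ℤ , ⊕-assoc v (p , 0ℤ) e₁)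

    not-in-row : ¬ InRow (v ⊕ e₂)
    not-in-row (_ , p , eq) = ∣k∣<d⇒d∤k 1ℤ (λ ()) 1<n (congruent₂ (⊕-cancelˡ v eq))

coprime⇒¬regular : ∀ {m n} .{{_ : NonZero m}} .{{_ : NonZero n}} → 1 ℕ.< m → 1 ℕ.< n →
                   gcd m n ≡ 1 → (C : Cycle (Torus.Vertex m n)) → ¬ (∀ x → Walk.Regular C x)
coprime⇒¬regular {m} {n} 1<m 1<n gcd≡1 C regular =
  Sum.[ ¬Step-e₁ v₀ , ¬Stepᵀ-e₁ (swap v₀) ∘ cong swap ]′ (regular v₀)
  where
  v₀ = Cyclic.fromℤ m 0ℤ , Cyclic.fromℤ n 0ℤ
  ¬Step-e₁ = regular-coprime⇒¬Step-e₁ 1<m 1<n gcd≡1 C regular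
  ¬Stepᵀ-e₁ = regular-coprime⇒¬Step-e₁ 1<n 1<m (trans (GCD.gcd-comm n m) gcd≡1) (transpose C)
                (λ x → Sum.swap (Sum.map (cong swap) (cong swap) (regular (swap x))))

-- The successor function of a hamiltonian cycle of P(C_m □ C_n), with v the reversed vertex.
record ReversedTorusCycle (m n : ℕ) .{{_ : NonZero m}} .{{_ : NonZero n}} (v : Torus.Vertex m n) : Set₁ where
  open Torus m n
  field
    cycle : Cycle Vertex
  open Cycle cycle
  field
    regular : ∀ x → x ≢ v → next x ≢ v → Walk.Regular cycle x
    leave   : next v ≡ v ⊕ -² e₁ ⊎ next v ≡ v ⊕ -² e₂
    enter   : ∀ x → next x ≡ v → x ≡ v ⊕ e₁ ⊎ x ≡ v ⊕ e₂

transposeᴿ : ∀ {m n} .{{_ : NonZero m}} .{{_ : NonZero n}} {v} →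
             ReversedTorusCycle m n v → ReversedTorusCycle n m (swap v)
transposeᴿ R = record
  { cycle   = transpose cycle
  ; regular = λ x x≢v nx≢v → mirror (regular (swap x) (x≢v ∘ cong swap) (nx≢v ∘ cong swap))
  ; leave   = mirror leave
  ; enter   = λ x eq → mirror (enter (swap x) (cong swap eq))
  }
  where
  open ReversedTorusCycle R
  mirror : ∀ {A B : Set} {a b c d : A × B} → a ≡ b ⊎ c ≡ d → swap c ≡ swap d ⊎ swap a ≡ swap b
  mirror = Sum.swap ∘ Sum.map (cong swap) (cong swap)

module Local {m n : ℕ} .{{_ : NonZero m}} .{{_ : NonZero n}} (2<m : 2 ℕ.< m) (2<n : 2 ℕ.< n)
             {v : Torus.Vertex m n} (R : ReversedTorusCycle m n v) where

  open Torus m n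
  open ReversedTorusCycle R
  open Cycle cycle
  open Walk cycle

  1<m : 1 ℕ.< m
  1<m = ℕP.<⇒≤ 2<m

  1<n : 1 ℕ.< n
  1<n = ℕP.<⇒≤ 2<n

  next-v≢v⊕e₁ : next v ≢ v ⊕ e₁
  next-v≢v⊕e₁ eq with leave
  ... | inj₁ l = ∣k∣<d⇒d∤k (- + 2) (λ ()) 2<m (congruent₁ (⊕-cancelˡ v (trans (sym l) eq)))
  ... | inj₂ l = ∣k∣<d⇒d∤k -1ℤ (λ ()) 1<m (congruent₁ (⊕-cancelˡ v (trans (sym l) eq)))

  v⊕ē₁≢v : v ⊕ -² e₁ ≢ v
  v⊕ē₁≢v eq = ∣k∣<d⇒d∤k -1ℤ (λ ()) 1<m (congruent₁ (⊕-fixed⇒≈0 v eq))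

  next-v⊕ē₁≢v : next (v ⊕ -² e₁) ≢ v
  next-v⊕ē₁≢v eq with enter _ eq
  ... | inj₁ x≡ = ∣k∣<d⇒d∤k (- + 2) (λ ()) 2<m (congruent₁ (⊕-cancelˡ v x≡))
  ... | inj₂ x≡ = ∣k∣<d⇒d∤k -1ℤ (λ ()) 1<m (congruent₁ (⊕-cancelˡ v x≡))

  next-v⊕ē₁ : next (v ⊕ -² e₁) ≡ v ⊕ δ
  next-v⊕ē₁ with regular _ v⊕ē₁≢v next-v⊕ē₁≢v
  ... | inj₁ s = ⊥-elim (next-v⊕ē₁≢v (trans s (trans (⊕-assoc v (-² e₁) e₁) (⊕-identityʳ v))))
  ... | inj₂ s = trans s (⊕-assoc v (-² e₁) e₂)

  v⊕e₁≢v : v ⊕ e₁ ≢ v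
  v⊕e₁≢v eq = ∣k∣<d⇒d∤k 1ℤ (λ ()) 1<m (congruent₁ (⊕-fixed⇒≈0 v eq))

  prev-v⊕e₁≢v : prev (v ⊕ e₁) ≢ v
  prev-v⊕e₁≢v eq = next-v≢v⊕e₁ (trans (cong next (sym eq)) (next-prev (v ⊕ e₁)))

  next-v⊕δ̄ : next (v ⊕ -² δ) ≡ v ⊕ e₁
  next-v⊕δ̄ with regular (prev (v ⊕ e₁)) prev-v⊕e₁≢v (v⊕e₁≢v ∘ trans (sym (next-prev _)))
  ... | inj₁ s = ⊥-elim (prev-v⊕e₁≢v (⊕-cancelʳ e₁ (trans (sym s) (next-prev _))))
  ... | inj₂ s = trans (cong next (sym prev≡)) (next-prev _)
    where
    prev≡ : prev (v ⊕ e₁) ≡ v ⊕ -² δ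
    prev≡ = trans (⊕-≡⇒≡-⊕ e₂ (trans (sym s) (next-prev _))) (⊕-assoc v e₁ (-² e₂))

  ¬Step-e₁-v⊕δ̄ : ¬ Step e₁ (v ⊕ -² δ)
  ¬Step-e₁-v⊕δ̄ s = ∣k∣<d⇒d∤k -1ℤ (λ ()) 1<n (congruent₂ (⊕-cancelˡ v
    (trans (sym (⊕-assoc v (-² δ) e₁)) (trans (sym s) next-v⊕δ̄))))

gcd>2⇒¬reversed : ∀ {m n} .{{_ : NonZero m}} .{{_ : NonZero n}} → 2 ℕ.< m → 2 ℕ.< n →
                  2 ℕ.< gcd m n → ∀ {v} → ¬ ReversedTorusCycle m n v
gcd>2⇒¬reversed {m} {n} 2<m 2<n 2<g {v} R =
  L.¬Step-e₁-v⊕δ̄ (proj₂ (antidiagonal-closed Invariant invariant v (divides 0ℤ refl) invariant-v⊕δ))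
  where
  open Torus m n
  open ReversedTorusCycle R
  open Cycle cycle
  open Walk cycle
  module L = Local 2<m 2<n R
  module Lᵀ = Local 2<n 2<m (transposeᴿ R)

  g = gcd m n

  Invariant : Vertex → Set
  Invariant x = OnDiagonal g v x × Step e₁ x

  invariant : ∀ x → Invariant x → Invariant (x ⊕ δ)
  invariant x (d@(u , refl , g∣u) , s) =
    onDiagonal-δ d , propagate L.1<m x (regular y y≢v next-y≢v) s
    where
    y = prev (x ⊕ e₂)
    next-y≡x⊕e₂ = next-prev (x ⊕ e₂)
    separated : ∀ {w} → ¬ + g ∣ diag e₂ - diag w → x ⊕ e₂ ≢ v ⊕ w
    separated = ⊕-≢-diag (GCD.gcd[m,n]∣m m n) (GCD.gcd[m,n]∣n m n) v g∣u
    next-y≢v : next y ≢ v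
    next-y≢v eq = separated (∣k∣<d⇒d∤k 1ℤ (λ ()) (ℕP.<⇒≤ 2<g))
      (trans (sym next-y≡x⊕e₂) (trans eq (sym (⊕-identityʳ v))))
    next-v≡x⊕e₂ : y ≡ v → next v ≡ x ⊕ e₂
    next-v≡x⊕e₂ eq = trans (cong next (sym eq)) next-y≡x⊕e₂
    y≢v : y ≢ v
    y≢v eq with leave
    ... | inj₁ l = separated (∣k∣<d⇒d∤k (+ 2) (λ ()) 2<g) (trans (sym (next-v≡x⊕e₂ eq)) l)
    ... | inj₂ l = separated (∣k∣<d⇒d∤k (+ 2) (λ ()) 2<g) (trans (sym (next-v≡x⊕e₂ eq)) l)

  invariant-v⊕δ : Invariant (v ⊕ δ)
  invariant-v⊕δ = (δ , refl , divides 0ℤ refl) , trans (cong swap Lᵀ.next-v⊕δ̄) (sym (⊕-assoc v δ e₁))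

module NoABPattern {m n : ℕ} .{{_ : NonZero m}} .{{_ : NonZero n}} (2<m : 2 ℕ.< m) (2<n : 2 ℕ.< n)
                   (gcd≡2 : gcd m n ≡ 2) {v : Torus.Vertex m n} (R : ReversedTorusCycle m n v) where

  open Torus m n
  open ReversedTorusCycle R
  open Cycle cycle
  open Walk cycle
  private
    module L = Local 2<m 2<n R
    module Lᵀ = Local 2<n 2<m (transposeᴿ R)

  ABPattern : Vertex → Set
  ABPattern x = Step e₁ x × Step e₂ (x ⊕ e₁)

  2∣m : 2 ℕ∣.∣ m
  2∣m = subst (ℕ∣._∣ m) gcd≡2 (GCD.gcd[m,n]∣m m n)

  2∣n : 2 ℕ∣.∣ n
  2∣n = subst (ℕ∣._∣ n) gcd≡2 (GCD.gcd[m,n]∣n m n)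

  private
    next-v⊕ē₂ : next (v ⊕ -² e₂) ≡ v ⊕ -² δ
    next-v⊕ē₂ = cong swap Lᵀ.next-v⊕ē₁

    ¬ABPattern-v⊕[-1,-1] : ¬ ABPattern (v ⊕ (-1ℤ , -1ℤ))
    ¬ABPattern-v⊕[-1,-1] (_ , s₂)
      with enter _ (trans s₂ (trans (⊕-assoc _ e₁ e₂) (trans (⊕-assoc v _ _) (⊕-identityʳ v))))
    ... | inj₁ eq = ∣k∣<d⇒d∤k -1ℤ (λ ()) L.1<m
                      (congruent₁ (⊕-cancelˡ v (trans (sym (⊕-assoc v _ e₁)) eq)))
    ... | inj₂ eq = ∣k∣<d⇒d∤k (- + 2) (λ ()) 2<n
                      (congruent₂ (⊕-cancelˡ v (trans (sym (⊕-assoc v _ e₁)) eq)))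

    ¬ABPattern-v⊕[0,-2] : ¬ ABPattern (v ⊕ (0ℤ , - + 2))
    ¬ABPattern-v⊕[0,-2] (_ , s₂) = ∣k∣<d⇒d∤k 1ℤ (λ ()) L.1<m (congruent₁ (⊕-cancelˡ v
      (trans (sym (⊕-assoc v _ e₁)) (next-injective (begin
        next (v ⊕ (0ℤ , - + 2) ⊕ e₁)      ≡⟨ s₂ ⟩
        v ⊕ (0ℤ , - + 2) ⊕ e₁ ⊕ e₂        ≡⟨ ⊕-assoc _ e₁ e₂ ⟩
        v ⊕ (0ℤ , - + 2) ⊕ (1ℤ , 1ℤ)      ≡⟨ ⊕-assoc v _ _ ⟩
        v ⊕ -² δ                          ≡⟨ sym next-v⊕ē₂ ⟩
        next (v ⊕ -² e₂)                  ∎)))))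
      where open ≡-Reasoning

  Invariant : Vertex → Set
  Invariant x = OnDiagonal 2 v x × ABPattern x

  invariant : ∀ x → Invariant x → Invariant (x ⊕ δ)
  invariant x (d@(u , refl , 2∣u) , ab@(s₁ , s₂)) =
    onDiagonal-δ d , step₁ , subst (Step e₂) (sym (⊕-assoc x δ e₁)) step₂
    where
    separated : ∀ {w} → ¬ + 2 ∣ diag e₂ - diag w → x ⊕ e₂ ≢ v ⊕ w
    separated = ⊕-≢-diag 2∣m 2∣n v 2∣u

    x⊕e₂≢v : x ⊕ e₂ ≢ v
    x⊕e₂≢v eq = separated (∣k∣<d⇒d∤k 1ℤ (λ ()) ℕP.≤-refl) (trans eq (sym (⊕-identityʳ v)))

    y = prev (x ⊕ e₂)
    next-y≡x⊕e₂ = next-prev (x ⊕ e₂)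

    -- Parity allows x ⊕ e₂ = next v, but only for these two positions of x.
    y≢v : y ≢ v
    y≢v eq with leave
    ... | inj₁ l = ¬ABPattern-v⊕[-1,-1] (subst ABPattern x≡ ab)
      where
      x≡ : x ≡ v ⊕ (-1ℤ , -1ℤ)
      x≡ = trans (⊕-≡⇒≡-⊕ e₂ (trans (sym next-y≡x⊕e₂) (trans (cong next eq) l))) (⊕-assoc v _ _)
    ... | inj₂ l = ¬ABPattern-v⊕[0,-2] (subst ABPattern x≡ ab)
      where
      x≡ : x ≡ v ⊕ (0ℤ , - + 2)
      x≡ = trans (⊕-≡⇒≡-⊕ e₂ (trans (sym next-y≡x⊕e₂) (trans (cong next eq) l))) (⊕-assoc v _ _)

    step₁ : Step e₁ (x ⊕ δ)
    step₁ = propagate L.1<m x (regular y y≢v (x⊕e₂≢v ∘ trans (sym next-y≡x⊕e₂))) s₁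

    next-x⊕e₂≢v : next (x ⊕ e₂) ≢ v
    next-x⊕e₂≢v eq with enter _ eq
    ... | inj₁ x⊕e₂≡ =
      L.¬Step-e₁-v⊕δ̄ (subst (Step e₁) (trans (⊕-≡⇒≡-⊕ e₂ x⊕e₂≡) (⊕-assoc v e₁ (-² e₂))) s₁)
    ... | inj₂ x⊕e₂≡ = L.next-v≢v⊕e₁ (subst (Step e₁) (⊕-cancelʳ e₂ x⊕e₂≡) s₁)

    step₂ : Step e₂ (x ⊕ e₂)
    step₂ with regular (x ⊕ e₂) x⊕e₂≢v next-x⊕e₂≢v
    ... | inj₂ s = s
    ... | inj₁ s = ⊥-elim (∣k∣<d⇒d∤k -1ℤ (λ ()) L.1<m
                     (congruent₁ (⊕-cancelˡ x (next-injective (begin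
      next (x ⊕ e₂)   ≡⟨ s ⟩
      x ⊕ e₂ ⊕ e₁     ≡⟨ ⊕-assoc x e₂ e₁ ⟩
      x ⊕ (1ℤ , 1ℤ)   ≡⟨ sym (⊕-assoc x e₁ e₂) ⟩
      x ⊕ e₁ ⊕ e₂     ≡⟨ sym s₂ ⟩
      next (x ⊕ e₁)   ∎)))))
      where open ≡-Reasoning

  no-ABPattern : ∀ x → OnDiagonal 2 v x → ¬ ABPattern x
  no-ABPattern x (u , refl , 2∣u) ab = L.¬Step-e₁-v⊕δ̄ (proj₁ (proj₂
    (antidiagonal-closed Invariant invariant v {u} { -² δ} gcd∣u ((u , refl , 2∣u) , ab))))
    where
    gcd∣u : + gcd m n ∣ diag u - 0ℤ
    gcd∣u = subst (λ g → + g ∣ diag u - 0ℤ) (sym gcd≡2)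
              (subst (+ 2 ∣_) (sym (ℤP.+-identityʳ (diag u))) 2∣u)

gcd≡2⇒¬reversed : ∀ {m n} .{{_ : NonZero m}} .{{_ : NonZero n}} → 2 ℕ.< m → 2 ℕ.< n →
                  gcd m n ≡ 2 → ∀ {v} → ¬ ReversedTorusCycle m n v
gcd≡2⇒¬reversed {m} {n} 2<m 2<n gcd≡2 {v} R =
  ¬reaches-v⊕[0,2] (induction Reaches (inj₁ (inj₁ refl)) reaches-next (v ⊕ (0ℤ , + 2)))
  where
  open Torus m n
  open ReversedTorusCycle R
  open Cycle cycle
  open Walk cycle
  module L = Local 2<m 2<n R
  module Lᵀ = Local 2<n 2<m (transposeᴿ R)
  module AB = NoABPattern 2<m 2<n gcd≡2 R
  module BA = NoABPattern 2<n 2<m (trans (GCD.gcd-comm n m) gcd≡2) (transposeᴿ R)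
  open AB using (2∣m; 2∣n)

  Parity : ℤ² → Vertex → Set
  Parity c x = ∃[ u ] x ≡ v ⊕ u × Congruent 2 2 u c

  parity-⊕ : ∀ {c x} w → Parity c x → Parity (c +² w) (x ⊕ w)
  parity-⊕ w (u , refl , u≡c) = u +² w , ⊕-assoc v u w , congruent-+² w u≡c

  parity-resp : ∀ {c c′ x} → Congruent 2 2 c c′ → Parity c x → Parity c′ x
  parity-resp c≡c′ (u , x≡ , u≡c) = u , x≡ , congruent-trans u≡c c≡c′

  parity-unique : ∀ {c c′ x} → Parity c x → Parity c′ x → Congruent 2 2 c c′
  parity-unique (u , refl , u≡c) (u′ , x≡ , u′≡c′) = congruent-trans (congruent-sym u≡c)
    (congruent-trans (congruent-coarsen 2∣m 2∣n (⊕-cancelˡ v x≡)) u′≡c′)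

  parity⇒onDiagonal : ∀ {x} → Parity (1ℤ , 1ℤ) x → OnDiagonal 2 v x
  parity⇒onDiagonal (u@(p , q) , x≡ , congruent 2∣p-1 2∣q-1) =
    u , x≡ , subst (+ 2 ∣_) (rearrange p q)
                   (∣m∣n⇒∣m+n (∣m∣n⇒∣m+n 2∣p-1 2∣q-1) (divides 1ℤ refl))
    where
    rearrange : ∀ p q → ((p - 1ℤ) + (q - 1ℤ)) + + 2 ≡ p + q
    rearrange = solve-∀

  parity-v : Parity (0ℤ , 0ℤ) v
  parity-v = (0ℤ , 0ℤ) , sym (⊕-identityʳ v) , congruent (divides 0ℤ refl) (divides 0ℤ refl)

  Good Odd Reaches : Vertex → Set
  Good x = x ≡ v ⊎ Parity (1ℤ , 1ℤ) x
  Odd x = Parity e₁ x ⊎ Parity e₂ x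
  Reaches x = Good x ⊎ (Odd x × Good (next x))

  good-step : ∀ x → Good x → Odd (next x) × Good (next (next x))
  good-step x (inj₁ refl) with leave
  ... | inj₁ l = inj₁ (-² e₁ , l , congruent (divides -1ℤ refl) (divides 0ℤ refl)) ,
                 inj₂ (δ , trans (cong next l) L.next-v⊕ē₁ ,
                       congruent (divides -1ℤ refl) (divides 0ℤ refl))
  ... | inj₂ l = inj₂ (-² e₂ , l , congruent (divides 0ℤ refl) (divides -1ℤ refl)) ,
                 inj₂ (-² δ , trans (cong next l) (cong swap Lᵀ.next-v⊕ē₁) ,
                       congruent (divides 0ℤ refl) (divides -1ℤ refl))
  good-step x (inj₂ odd-odd) with regular x x≢v next-x≢v
    where
    x≢v : x ≢ v
    x≢v refl = ∣k∣<d⇒d∤k 1ℤ (λ ()) ℕP.≤-refl (congruent₁ (parity-unique odd-odd parity-v))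
    next-x≢v : next x ≢ v
    next-x≢v eq with enter x eq
    ... | inj₁ x≡ = ∣k∣<d⇒d∤k 1ℤ (λ ()) ℕP.≤-refl (congruent₂ (parity-unique {c′ = e₁} odd-odd
                      (e₁ , x≡ , congruent (divides 0ℤ refl) (divides 0ℤ refl))))
    ... | inj₂ x≡ = ∣k∣<d⇒d∤k 1ℤ (λ ()) ℕP.≤-refl (congruent₁ (parity-unique {c′ = e₂} odd-odd
                      (e₂ , x≡ , congruent (divides 0ℤ refl) (divides 0ℤ refl))))
  ... | inj₁ s₁ = inj₂ (subst (Parity e₂) (sym s₁) (parity-resp
                    (congruent (divides 1ℤ refl) (divides 0ℤ refl)) (parity-⊕ e₁ odd-odd))) ,
                  good-next-y
    where
    y = x ⊕ e₁
    parity-y : Parity (+ 2 , 1ℤ) y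
    parity-y = parity-⊕ e₁ odd-odd
    y≢v : y ≢ v
    y≢v refl = ∣k∣<d⇒d∤k 1ℤ (λ ()) ℕP.≤-refl (congruent₂ (parity-unique parity-y parity-v))
    good-next-y : Good (next (next x))
    good-next-y with next y ≟ v
    ... | yes eq = inj₁ (trans (cong next s₁) eq)
    ... | no ne with regular y y≢v ne
    ...   | inj₁ s = inj₂ (subst (Parity _) (sym (trans (cong next s₁) s)) (parity-resp
                       (congruent (divides 1ℤ refl) (divides 0ℤ refl)) (parity-⊕ e₁ parity-y)))
    ...   | inj₂ s = ⊥-elim (AB.no-ABPattern x (parity⇒onDiagonal odd-odd) (s₁ , s))
  ... | inj₂ s₁ = inj₁ (subst (Parity e₁) (sym s₁) (parity-resp
                    (congruent (divides 0ℤ refl) (divides 1ℤ refl)) (parity-⊕ e₂ odd-odd))) ,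
                  good-next-y
    where
    y = x ⊕ e₂
    parity-y : Parity (1ℤ , + 2) y
    parity-y = parity-⊕ e₂ odd-odd
    y≢v : y ≢ v
    y≢v refl = ∣k∣<d⇒d∤k 1ℤ (λ ()) ℕP.≤-refl (congruent₁ (parity-unique parity-y parity-v))
    good-next-y : Good (next (next x))
    good-next-y with next y ≟ v
    ... | yes eq = inj₁ (trans (cong next s₁) eq)
    ... | no ne with regular y y≢v ne
    ...   | inj₂ s = inj₂ (subst (Parity _) (sym (trans (cong next s₁) s)) (parity-resp
                       (congruent (divides 0ℤ refl) (divides 1ℤ refl)) (parity-⊕ e₂ parity-y)))
    ...   | inj₁ s = ⊥-elim (BA.no-ABPattern (swap x) (transpose-onDiagonal (parity⇒onDiagonal odd-odd))
                                            (cong swap s₁ , cong swap s))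

  reaches-next : ∀ x → Reaches x → Reaches (next x)
  reaches-next x (inj₁ good) = inj₂ (good-step x good)
  reaches-next x (inj₂ (_ , good)) = inj₁ good

  parity-v⊕[0,2] : Parity (0ℤ , + 2) (v ⊕ (0ℤ , + 2))
  parity-v⊕[0,2] = _ , refl , congruent (divides 0ℤ refl) (divides 0ℤ refl)

  ¬reaches-v⊕[0,2] : ¬ Reaches (v ⊕ (0ℤ , + 2))
  ¬reaches-v⊕[0,2] (inj₁ (inj₁ eq)) = ∣k∣<d⇒d∤k (+ 2) (λ ()) 2<n (congruent₂ (⊕-fixed⇒≈0 v eq))
  ¬reaches-v⊕[0,2] (inj₁ (inj₂ p)) =
    ∣k∣<d⇒d∤k 1ℤ (λ ()) ℕP.≤-refl (congruent₁ (parity-unique p parity-v⊕[0,2]))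
  ¬reaches-v⊕[0,2] (inj₂ (inj₁ p , _)) =
    ∣k∣<d⇒d∤k 1ℤ (λ ()) ℕP.≤-refl (congruent₁ (parity-unique p parity-v⊕[0,2]))
  ¬reaches-v⊕[0,2] (inj₂ (inj₂ p , _)) =
    ∣k∣<d⇒d∤k -1ℤ (λ ()) ℕP.≤-refl (congruent₂ (parity-unique p parity-v⊕[0,2]))

module _ {m′ n′ : ℕ} where

  private
    m n : ℕ
    m = suc m′
    n = suc n′

  open Torus m n

  □-edge : ∀ {x y} → E (DirCycle m □ DirCycle n) x y → y ≡ x ⊕ e₁ ⊎ y ≡ x ⊕ e₂
  □-edge {i , j} (inj₁ (refl , refl)) = inj₂ (cong₂ _,_ (sym (Cyclic.⊕-identityʳ m i)) (sucMod≡⊕1 j))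
  □-edge {i , j} (inj₂ (refl , refl)) = inj₁ (cong₂ _,_ (sucMod≡⊕1 i) (sym (Cyclic.⊕-identityʳ n j)))

  hamiltonian⇒regular : HamiltonianCycle (DirCycle m □ DirCycle n) →
                        Σ (Cycle Vertex) λ C → ∀ x → Walk.Regular C x
  hamiltonian⇒regular hc with hamiltonian⇒cycle (DirCycle m □ DirCycle n) hc
  ... | C , edge = C , λ x → □-edge (edge x)

  hamiltonian⇒reversed : ∀ v → HamiltonianCycle (reverseAt (DirCycle m □ DirCycle n) v) →
                         ReversedTorusCycle m n v
  hamiltonian⇒reversed v hc with hamiltonian⇒cycle (reverseAt (DirCycle m □ DirCycle n) v) hc
  ... | C , edge = record { cycle = C ; regular = regular ; leave = leave ; enter = enter }
    where
    open Cycle C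

    regular : ∀ x → x ≢ v → next x ≢ v → Walk.Regular C x
    regular x x≢v next-x≢v with edge x
    ... | inj₁ (_ , _ , e)         = □-edge e
    ... | inj₂ (inj₁ x≡v , _)      = ⊥-elim (x≢v x≡v)
    ... | inj₂ (inj₂ next-x≡v , _) = ⊥-elim (next-x≢v next-x≡v)

    leave : next v ≡ v ⊕ -² e₁ ⊎ next v ≡ v ⊕ -² e₂
    leave with edge v
    ... | inj₁ (v≢v , _) = ⊥-elim (v≢v refl)
    ... | inj₂ (_ , e)   = Sum.map (⊕-≡⇒≡-⊕ e₁ ∘ sym) (⊕-≡⇒≡-⊕ e₂ ∘ sym) (□-edge e)

    enter : ∀ x → next x ≡ v → x ≡ v ⊕ e₁ ⊎ x ≡ v ⊕ e₂
    enter x next-x≡v with edge x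
    ... | inj₁ (_ , next-x≢v , _) = ⊥-elim (next-x≢v next-x≡v)
    ... | inj₂ (_ , e)            = subst (λ y → x ≡ y ⊕ e₁ ⊎ x ≡ y ⊕ e₂) next-x≡v (□-edge e)

≢0⇒≡1⊎≡2⊎>2 : ∀ {g} → g ≢ 0 → g ≡ 1 ⊎ g ≡ 2 ⊎ 2 ℕ.< g
≢0⇒≡1⊎≡2⊎>2 {zero}              g≢0 = ⊥-elim (g≢0 refl)
≢0⇒≡1⊎≡2⊎>2 {1}                 _   = inj₁ refl
≢0⇒≡1⊎≡2⊎>2 {2}                 _   = inj₂ (inj₁ refl)
≢0⇒≡1⊎≡2⊎>2 {suc (suc (suc _))} _   = inj₂ (inj₂ (s≤s (s≤s (s≤s z≤n))))

corollary1p2 : (m n : ℕ) → m ≥ 3 → n ≥ 3 →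
    HamiltonianCycle (DirCycle m □ DirCycle n) →
    (v : V (DirCycle m □ DirCycle n)) →
    ¬ HamiltonianCycle (reverseAt (DirCycle m □ DirCycle n) v)
corollary1p2 zero    _       ()  _   _  _ _
corollary1p2 (suc _) zero    _   ()  _  _ _
corollary1p2 (suc m′) (suc n′) 2<m 2<n hX v hP
  with ≢0⇒≡1⊎≡2⊎>2 (GCD.gcd[m,n]≢0 (suc m′) (suc n′) (inj₁ (λ ())))
... | inj₁ gcd≡1 = coprime⇒¬regular (ℕP.<⇒≤ 2<m) (ℕP.<⇒≤ 2<n) gcd≡1 (proj₁ C) (proj₂ C)
  where C = hamiltonian⇒regular hX
... | inj₂ (inj₁ gcd≡2) = gcd≡2⇒¬reversed 2<m 2<n gcd≡2 (hamiltonian⇒reversed v hP)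
... | inj₂ (inj₂ 2<gcd) = gcd>2⇒¬reversed 2<m 2<n 2<gcd (hamiltonian⇒reversed v hP)
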